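{- Suppose $p\ge 4$ is an integer such that $p=kd$ for some $k,d \in \mathbb{Z}^+$, $1<k,d<p$. Then, for all integers $0\le i,j\le d$, \[ \Phi (p,d,[i,j])=\sum\limits_{s=i}^{d}\sum\limits_{t=j}^{d}\Bigg[(-1)^{(s-i)+(t-j)}{{2d}\choose{s,t, 2d-(s+t)}}{{(2d-(s+t))k}\choose{(d-t)k}}{{s}\choose{i}}{{t}\choose{j}}\Bigg]. \]
   Context: Let $p\ge 4$ be an integer with $p=kd$ for some positive integers $k,d$ with $1<k,d<p$. For nonnegative integers $i,j$, $[i,j]$ denotes the set of integer tuples $(x_1,x_2,\ldots,x_{2d})$ satisfying $x_1+x_2+\ldots+x_{2d}=p$, such that exactly $i$ of the coordinates equal $0$, exactly $j$ of the coordinates equal $k$, and every other coordinate $x_r$ satisfies $1\le x_r\le k-1$. Define $\Phi(p,d,[i,j]):=\sum_{(x_1,\ldots,x_{2d})\in [i,j]}\binom{k}{x_1}\binom{k}{x_2}\cdots\binom{k}{x_{2d}}$. Here $\binom{2d}{s,t,2d-(s+t)}=\frac{(2d)!}{s!\,t!\,(2d-s-t)!}$ denotes the multinomial coefficient. -}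

module Defs where

open import Data.Nat using (ℕ; zero; suc; _+_; _*_; _∸_; _≡ᵇ_; _!; _/_)
open import Data.Nat.Properties using (m*n≢0)
open import Data.Nat.Properties using (_!≢0)
open import Data.Nat.Combinatorics using (_C_)
open import Data.Bool using (Bool; true; false; if_then_else_; _∧_)
open import Data.List using (List; []; _∷_; map; concatMap; upTo; applyUpTo)
open import Data.Nat.ListAction using (sum)
open import Data.Vec as V using (Vec; []; _∷_)
open import Data.Integer as ℤ using (ℤ)

boundedVecs : (n b : ℕ) → List (Vec ℕ n)
boundedVecs zero    b = [] ∷ []
boundedVecs (suc n) b = concatMap (λ x → map (x ∷_) (boundedVecs n b)) (upTo (suc b))

countEq : ∀ {n} → ℕ → Vec ℕ n → ℕ
countEq a []       = 0
countEq a (x ∷ xs) = (if x ≡ᵇ a then 1 else 0) + countEq a xs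

-- membership of a tuple (x₁,…,x_{2d}) in the class [i,j] (for p = k d):
-- the coordinates sum to p, exactly i coordinates are 0, exactly j equal k.
-- Coordinates ranging over {0,…,k} (enumerated by boundedVecs), the remaining
-- ones automatically satisfy 1 ≤ x_r ≤ k-1 (k > 1 so 0 ≠ k).
inClass : ∀ {n} → (p k i j : ℕ) → Vec ℕ n → Bool
inClass p k i j v =
  (V.sum v ≡ᵇ p) ∧ (countEq 0 v ≡ᵇ i) ∧ (countEq k v ≡ᵇ j)

binomProd : ∀ {n} → ℕ → Vec ℕ n → ℕ
binomProd k []       = 1
binomProd k (x ∷ xs) = (k C x) * binomProd k xs

-- Φ(p,d,[i,j]) with k the cofactor: tuples have length 2d
Φ : (p d k i j : ℕ) → ℕ
Φ p d k i j =
  sum (map (λ v → if inClass p k i j v then binomProd k v else 0)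
           (boundedVecs (2 * d) k))

multinom : (n s t : ℕ) → ℕ
multinom n s t =
  _/_ (n !) ((s ! * t !) * (n ∸ (s + t)) !)
      {{m*n≢0 (s ! * t !) ((n ∸ (s + t)) !) {{m*n≢0 (s !) (t !) {{s !≢0}} {{t !≢0}}}} {{(n ∸ (s + t)) !≢0}}}}

-- Σ_{s=a}^{b} f s   (empty if b < a)
Σ[_⋯_] : ℕ → ℕ → (ℕ → ℤ) → ℤ
Σ[ a ⋯ b ] f = Data.List.foldr ℤ._+_ (ℤ.+ 0) (applyUpTo (λ r → f (a + r)) (suc b ∸ a))

sign : ℕ → ℤ
sign zero          = ℤ.+ 1
sign (suc zero)    = ℤ.- (ℤ.+ 1)
sign (suc (suc n)) = sign n

RHS : (d k i j : ℕ) → ℤ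
RHS d k i j =
  Σ[ i ⋯ d ] λ s → Σ[ j ⋯ d ] λ t →
    sign ((s ∸ i) + (t ∸ j)) ℤ.*
    ℤ.+ (multinom (2 * d) s t * (((2 * d ∸ (s + t)) * k) C ((d ∸ t) * k))
         * (s C i) * (t C j))

-- Binomial inversion writes the indicator of "exactly i zero coordinates" as
-- ∑ₛ (-1)^(s-i) C(s,i) C(#zeros,s), and likewise for the coordinates equal to k. So Φ becomes
-- an alternating sum of weighted counts of tuples with s marked zeros and t marked k's. Those
-- marks are placed in (2d choose s,t,2d-s-t) ways, and by Vandermonde the 2d-s-t unmarked
-- coordinates in {0,…,k}, summing to kd - tk, contribute C((2d-s-t)k, (d-t)k). Formally, the
-- count and this closed form satisfy the same recurrence in the number of coordinates.

module Submission where

open import Defs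
open import Data.Nat using (ℕ; _*_; _≤_; _<_)
open import Data.Integer using (+_)
open import Relation.Binary.PropositionalEquality using (_≡_)

open import Algebra.Bundles using (CommutativeSemiring)
open import Data.Bool using (Bool; true; false; if_then_else_; _∧_; T)
open import Data.Fin using (toℕ)
open import Data.Fin.Properties using (toℕ<n)
import Data.Integer as ℤ
open ℤ using (ℤ)
import Data.Integer.Properties as ℤₚ
import Data.Integer.Tactic.RingSolver as ℤ-Solver
open import Data.List using (List; []; _∷_; _++_; map; concatMap; upTo; applyUpTo; foldr)
import Data.List.Properties as List
open import Data.Nat using (zero; suc; _+_; _∸_; _≡ᵇ_; _!; z≤n; s≤s; NonZero; >-nonZero)
open import Data.Nat.Combinatorics
  using (_C_; nCk≡nC[n∸k]; nCn≡1; k>n⇒nCk≡0; nCk+nC[k+1]≡[n+1]C[k+1]; nCk≡n!/k![n-k]!; k![n∸k]!∣n!)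
open import Data.Nat.DivMod using (m*n/n≡m; m/n*n≡m; /-congˡ)
open import Data.Nat.ListAction using (sum)
open import Data.Nat.ListAction.Properties using (sum-++)
open import Data.Nat.Properties using (_!≢0; _!*_!≢0)
import Data.Nat.Properties as ℕₚ
open import Algebra.Properties.CommutativeSemigroup ℕₚ.*-commutativeSemigroup using ()
  renaming (x∙yz≈y∙xz to x*[y*z]≡y*[x*z])
open import Data.Nat.Solver using (module +-*-Solver)
open +-*-Solver using (solve; _:+_; _:*_; _:=_)
open import Data.Unit using (tt)
open import Data.Vec as V using (Vec; []; _∷_)
open import Relation.Binary.PropositionalEquality using (refl; sym; trans; cong; cong₂; subst; module ≡-Reasoning)
open import Relation.Nullary using (yes; no)

module RangeSum {c ℓ} (R : CommutativeSemiring c ℓ) where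
  open CommutativeSemiring R renaming (_+_ to _⊕_; _*_ to _⊛_; refl to ≈-refl; sym to ≈-sym; trans to ≈-trans)
  open import Algebra.Properties.Semiring.Sum semiring
    using (sum-syntax; sum-cong-≋; sum-replicate-zero; ∑-distrib-+; ∑-comm; *-distribˡ-sum; *-distribʳ-sum)

  -- ∑< (suc n) f unfolds definitionally to f 0 ⊕ ∑< n (λ x → f (suc x)).
  ∑< : ℕ → (ℕ → Carrier) → Carrier
  ∑< n f = ∑[ x < n ] f (toℕ x)

  ∑<-cong : ∀ n {f g : ℕ → Carrier} → (∀ x → x < n → f x ≈ g x) → ∑< n f ≈ ∑< n g
  ∑<-cong n f≈g = sum-cong-≋ (λ x → f≈g (toℕ x) (toℕ<n x))

  ∑<-zero : ∀ n {f : ℕ → Carrier} → (∀ x → x < n → f x ≈ 0#) → ∑< n f ≈ 0#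
  ∑<-zero n f≈0 = ≈-trans (∑<-cong n f≈0) (sum-replicate-zero n)

  ∑<-distrib-+ : ∀ n (f g : ℕ → Carrier) → ∑< n (λ x → f x ⊕ g x) ≈ ∑< n f ⊕ ∑< n g
  ∑<-distrib-+ n f g = ∑-distrib-+ {n} (λ x → f (toℕ x)) (λ x → g (toℕ x))

  ∑<-distribˡ-* : ∀ n a (f : ℕ → Carrier) → ∑< n (λ x → a ⊛ f x) ≈ a ⊛ ∑< n f
  ∑<-distribˡ-* n a f = ≈-sym (*-distribˡ-sum {n} a (λ x → f (toℕ x)))

  ∑<-distribʳ-* : ∀ n a (f : ℕ → Carrier) → ∑< n (λ x → f x ⊛ a) ≈ ∑< n f ⊛ a
  ∑<-distribʳ-* n a f = ≈-sym (*-distribʳ-sum {n} a (λ x → f (toℕ x)))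

  ∑<-comm : ∀ m n (f : ℕ → ℕ → Carrier) →
    ∑< m (λ x → ∑< n (f x)) ≈ ∑< n (λ y → ∑< m (λ x → f x y))
  ∑<-comm m n f = ∑-comm {m} {n} (λ x y → f (toℕ x) (toℕ y))

  ∑<-last : ∀ n (f : ℕ → Carrier) → ∑< (suc n) f ≈ ∑< n f ⊕ f n
  ∑<-last zero    f = +-comm _ _
  ∑<-last (suc n) f = ≈-trans (+-congˡ (∑<-last n (λ x → f (suc x)))) (≈-sym (+-assoc _ _ _))

  ∑<-split : ∀ m n (f : ℕ → Carrier) → ∑< (m + n) f ≈ ∑< m f ⊕ ∑< n (λ y → f (m + y))
  ∑<-split zero    n f = ≈-sym (+-identityˡ _)
  ∑<-split (suc m) n f = ≈-trans (+-congˡ (∑<-split m n (λ y → f (suc y)))) (≈-sym (+-assoc _ _ _))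

  foldr-applyUpTo : ∀ n (u : ℕ → Carrier) → foldr _⊕_ 0# (applyUpTo u n) ≈ ∑< n u
  foldr-applyUpTo zero    u = ≈-refl
  foldr-applyUpTo (suc n) u = +-congˡ (foldr-applyUpTo n (λ x → u (suc x)))

  ∑<-product : ∀ m n (f g : ℕ → Carrier) → ∑< m f ⊛ ∑< n g ≈ ∑< m (λ x → ∑< n (λ y → f x ⊛ g y))
  ∑<-product m n f g = ≈-trans (≈-sym (∑<-distribʳ-* m (∑< n g) f))
                               (∑<-cong m (λ x _ → ≈-sym (∑<-distribˡ-* n (f x) g)))

  ∑<-restrict : ∀ {i d N} (f : ℕ → Carrier) → i ≤ d → d ≤ N →
    (∀ x → x < i → f x ≈ 0#) → (∀ x → d < x → f x ≈ 0#) → ∑< (suc N) f ≈ ∑< (suc d ∸ i) (λ r → f (i + r))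
  ∑<-restrict {i} {d} {N} f i≤d d≤N below above = begin
    ∑< (suc N) f
      ≡⟨ cong (λ e → ∑< e f) (trans (cong suc (sym (ℕₚ.m+[n∸m]≡n d≤N))) (cong (_+ (N ∸ d)) (sym i+L≡1+d))) ⟩
    ∑< (i + L + (N ∸ d)) f
      ≈⟨ ∑<-split (i + L) (N ∸ d) f ⟩
    ∑< (i + L) f ⊕ ∑< (N ∸ d) (λ y → f (i + L + y))
      ≈⟨ +-cong (∑<-split i L f) (∑<-zero (N ∸ d) (λ y _ → above (i + L + y) (d<i+L+y y))) ⟩
    ∑< i f ⊕ ∑< L (λ r → f (i + r)) ⊕ 0#
      ≈⟨ ≈-trans (+-identityʳ _) (+-congʳ (∑<-zero i below)) ⟩
    0# ⊕ ∑< L (λ r → f (i + r))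
      ≈⟨ +-identityˡ _ ⟩
    ∑< L (λ r → f (i + r)) ∎
    where
    open import Relation.Binary.Reasoning.Setoid setoid
    L = suc d ∸ i
    i+L≡1+d : i + L ≡ suc d
    i+L≡1+d = ℕₚ.m+[n∸m]≡n (ℕₚ.m≤n⇒m≤1+n i≤d)
    d<i+L+y : ∀ y → d < i + L + y
    d<i+L+y y = subst (λ e → d < e + y) (sym i+L≡1+d) (s≤s (ℕₚ.m≤m+n d y))

  ∑Vec : (b n : ℕ) → (Vec ℕ n → Carrier) → Carrier
  ∑Vec b zero    f = f []
  ∑Vec b (suc n) f = ∑< (suc b) (λ x → ∑Vec b n (λ w → f (x ∷ w)))

  ∑Vec-cong : ∀ b n {f g : Vec ℕ n → Carrier} → (∀ v → f v ≈ g v) → ∑Vec b n f ≈ ∑Vec b n g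
  ∑Vec-cong b zero    f≈g = f≈g []
  ∑Vec-cong b (suc n) f≈g = ∑<-cong (suc b) (λ x _ → ∑Vec-cong b n (λ w → f≈g (x ∷ w)))

  ∑Vec-zero : ∀ b n → ∑Vec b n (λ _ → 0#) ≈ 0#
  ∑Vec-zero b zero    = ≈-refl
  ∑Vec-zero b (suc n) = ∑<-zero (suc b) (λ _ _ → ∑Vec-zero b n)

  ∑Vec-distribˡ-* : ∀ b n a (f : Vec ℕ n → Carrier) → ∑Vec b n (λ v → a ⊛ f v) ≈ a ⊛ ∑Vec b n f
  ∑Vec-distribˡ-* b zero    a f = ≈-refl
  ∑Vec-distribˡ-* b (suc n) a f =
    ≈-trans (∑<-cong (suc b) (λ x _ → ∑Vec-distribˡ-* b n a (λ w → f (x ∷ w))))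
          (∑<-distribˡ-* (suc b) a (λ x → ∑Vec b n (λ w → f (x ∷ w))))

  ∑Vec-distrib-+ : ∀ b n (f g : Vec ℕ n → Carrier) → ∑Vec b n (λ v → f v ⊕ g v) ≈ ∑Vec b n f ⊕ ∑Vec b n g
  ∑Vec-distrib-+ b zero    f g = ≈-refl
  ∑Vec-distrib-+ b (suc n) f g =
    ≈-trans (∑<-cong (suc b) (λ x _ → ∑Vec-distrib-+ b n (λ w → f (x ∷ w)) (λ w → g (x ∷ w))))
          (∑<-distrib-+ (suc b) (λ x → ∑Vec b n (λ w → f (x ∷ w))) (λ x → ∑Vec b n (λ w → g (x ∷ w))))

  ∑Vec-∑<-comm : ∀ b n m (f : Vec ℕ n → ℕ → Carrier) →
    ∑Vec b n (λ v → ∑< m (f v)) ≈ ∑< m (λ y → ∑Vec b n (λ v → f v y))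
  ∑Vec-∑<-comm b zero    m f = ≈-refl
  ∑Vec-∑<-comm b (suc n) m f =
    ≈-trans (∑<-cong (suc b) (λ x _ → ∑Vec-∑<-comm b n m (λ w → f (x ∷ w))))
          (∑<-comm (suc b) m (λ x y → ∑Vec b n (λ w → f (x ∷ w) y)))

open RangeSum ℕₚ.+-*-commutativeSemiring
module ℤΣ = RangeSum ℤₚ.+-*-commutativeSemiring

binom : ℕ → ℕ → ℕ
binom zero    zero    = 1
binom zero    (suc k) = 0
binom (suc n) zero    = 1
binom (suc n) (suc k) = binom n k + binom n (suc k)

binom[n,0]≡1 : ∀ n → binom n 0 ≡ 1
binom[n,0]≡1 zero    = refl
binom[n,0]≡1 (suc n) = refl

n<k⇒binom≡0 : ∀ {n k} → n < k → binom n k ≡ 0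
n<k⇒binom≡0 {zero}  {suc k} _         = refl
n<k⇒binom≡0 {suc n} {suc k} (s≤s n<k) =
  cong₂ _+_ (n<k⇒binom≡0 n<k) (n<k⇒binom≡0 (ℕₚ.m<n⇒m<1+n n<k))

binom[n,n]≡1 : ∀ n → binom n n ≡ 1
binom[n,n]≡1 zero    = refl
binom[n,n]≡1 (suc n) = cong₂ _+_ (binom[n,n]≡1 n) (n<k⇒binom≡0 (ℕₚ.n<1+n n))

binom≡C : ∀ n k → binom n k ≡ n C k
binom≡C n       zero    = trans (binom[n,0]≡1 n) (sym (trans (nCk≡nC[n∸k] {0} {n} z≤n) (nCn≡1 n)))
binom≡C zero    (suc k) = sym (k>n⇒nCk≡0 {0} {suc k} (s≤s z≤n))
binom≡C (suc n) (suc k) =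
  trans (cong₂ _+_ (binom≡C n k) (binom≡C n (suc k))) (nCk+nC[k+1]≡[n+1]C[k+1] n k)

-- shift c f is f delayed by c steps: on generating functions, multiplication by X^c.
shift : ℕ → (ℕ → ℕ) → ℕ → ℕ
shift zero    f m       = f m
shift (suc c) f zero    = 0
shift (suc c) f (suc m) = shift c f m

shift-cong : ∀ c {f g : ℕ → ℕ} m → (∀ y → f y ≡ g y) → shift c f m ≡ shift c g m
shift-cong zero    m       f≡g = f≡g m
shift-cong (suc c) zero    f≡g = refl
shift-cong (suc c) (suc m) f≡g = shift-cong c m f≡g

shift-≤ : ∀ {c m} (f : ℕ → ℕ) → c ≤ m → shift c f m ≡ f (m ∸ c)
shift-≤ {zero}          f _         = refl
shift-≤ {suc c} {suc m} f (s≤s c≤m) = shift-≤ f c≤m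

shift-< : ∀ {c m} (f : ℕ → ℕ) → m < c → shift c f m ≡ 0
shift-< {suc c} {zero}  f _         = refl
shift-< {suc c} {suc m} f (s≤s m<c) = shift-< f m<c

shift-shift : ∀ x c (f : ℕ → ℕ) m → shift x (shift c f) m ≡ shift (x + c) f m
shift-shift zero    c f m       = refl
shift-shift (suc x) c f zero    = refl
shift-shift (suc x) c f (suc m) = shift-shift x c f m

shift-zero : ∀ c m → shift c (λ _ → 0) m ≡ 0
shift-zero zero    m       = refl
shift-zero (suc c) zero    = refl
shift-zero (suc c) (suc m) = shift-zero c m

shift-natural : ∀ {A : Set} (F : (A → ℕ) → ℕ) → F (λ _ → 0) ≡ 0 →
  ∀ c (G : A → ℕ → ℕ) m → shift c (λ y → F (λ a → G a y)) m ≡ F (λ a → shift c (G a) m)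
shift-natural F F0≡0 zero    G m       = refl
shift-natural F F0≡0 (suc c) G zero    = sym F0≡0
shift-natural F F0≡0 (suc c) G (suc m) = shift-natural F F0≡0 c G m

shift-*ˡ : ∀ c a (f : ℕ → ℕ) m → shift c (λ y → a * f y) m ≡ a * shift c f m
shift-*ˡ c a f = shift-natural (λ g → a * g tt) (ℕₚ.*-zeroʳ a) c (λ _ → f)

shift-*ʳ : ∀ c a (f : ℕ → ℕ) m → shift c (λ y → f y * a) m ≡ shift c f m * a
shift-*ʳ c a f = shift-natural (λ g → g tt * a) refl c (λ _ → f)

binom-suc : ∀ n m → binom (suc n) m ≡ binom n m + shift 1 (binom n) m
binom-suc n zero    = sym (trans (ℕₚ.+-identityʳ _) (binom[n,0]≡1 n))
binom-suc n (suc m) = ℕₚ.+-comm (binom n m) (binom n (suc m))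

-- The coefficients of (1 + X)^k · ∑ g m X^m.
convBinom : ℕ → (ℕ → ℕ) → ℕ → ℕ
convBinom k g m = ∑< (suc k) (λ x → binom k x * shift x g m)

convBinom-cong : ∀ k {f g : ℕ → ℕ} m → (∀ y → f y ≡ g y) → convBinom k f m ≡ convBinom k g m
convBinom-cong k m f≡g = ∑<-cong (suc k) (λ x _ → cong (binom k x *_) (shift-cong x m f≡g))

convBinom-*ˡ : ∀ k a (g : ℕ → ℕ) m → convBinom k (λ y → a * g y) m ≡ a * convBinom k g m
convBinom-*ˡ k a g m = begin
  ∑< (suc k) (λ x → binom k x * shift x (λ y → a * g y) m)
    ≡⟨ ∑<-cong (suc k) (λ x _ → cong (binom k x *_) (shift-*ˡ x a g m)) ⟩
  ∑< (suc k) (λ x → binom k x * (a * shift x g m))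
    ≡⟨ ∑<-cong (suc k) (λ x _ → x*[y*z]≡y*[x*z] (binom k x) a (shift x g m)) ⟩
  ∑< (suc k) (λ x → a * (binom k x * shift x g m))
    ≡⟨ ∑<-distribˡ-* (suc k) a (λ x → binom k x * shift x g m) ⟩
  a * convBinom k g m ∎
  where open ≡-Reasoning

convBinom-shift : ∀ k c (g : ℕ → ℕ) m → convBinom k (shift c g) m ≡ shift c (convBinom k g) m
convBinom-shift k c g m = begin
  ∑< (suc k) (λ x → binom k x * shift x (shift c g) m)
    ≡⟨ ∑<-cong (suc k) (λ x _ → cong (binom k x *_) (shifts-commute x)) ⟩
  ∑< (suc k) (λ x → binom k x * shift c (shift x g) m)
    ≡⟨ ∑<-cong (suc k) (λ x _ → sym (shift-*ˡ c (binom k x) (shift x g) m)) ⟩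
  ∑< (suc k) (λ x → shift c (λ y → binom k x * shift x g y) m)
    ≡⟨ sym (shift-natural (∑< (suc k)) (∑<-zero (suc k) (λ _ _ → refl)) c (λ x y → binom k x * shift x g y) m) ⟩
  shift c (convBinom k g) m ∎
  where
  open ≡-Reasoning
  shifts-commute : ∀ x → shift x (shift c g) m ≡ shift c (shift x g) m
  shifts-commute x = trans (shift-shift x c g m)
    (trans (cong (λ e → shift e g m) (ℕₚ.+-comm x c)) (sym (shift-shift c x g m)))

vandermonde : ∀ k a m → convBinom k (binom a) m ≡ binom (a + k) m
vandermonde zero    a m = trans (ℕₚ.+-identityʳ _) (trans (ℕₚ.*-identityˡ _) (cong (λ e → binom e m) (sym (ℕₚ.+-identityʳ a))))
vandermonde (suc k) a m = begin
  ∑< (suc (suc k)) (λ x → binom (suc k) x * shift x (binom a) m)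
    ≡⟨ ∑<-cong (suc (suc k)) (λ x _ → trans (cong (_* shift x (binom a) m) (binom-suc k x))
                                           (ℕₚ.*-distribʳ-+ (shift x (binom a) m) (binom k x) _)) ⟩
  ∑< (suc (suc k)) (λ x → binom k x * shift x (binom a) m + shift 1 (binom k) x * shift x (binom a) m)
    ≡⟨ ∑<-distrib-+ (suc (suc k)) (λ x → binom k x * shift x (binom a) m) (λ x → shift 1 (binom k) x * shift x (binom a) m) ⟩
  ∑< (suc (suc k)) (λ x → binom k x * shift x (binom a) m) + ∑< (suc (suc k)) (λ x → shift 1 (binom k) x * shift x (binom a) m)
    ≡⟨ cong₂ _+_ (trans (∑<-last (suc k) (λ x → binom k x * shift x (binom a) m)) drop-top)
                 (trans drop-bottom (convBinom-shift k 1 (binom a) m)) ⟩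
  convBinom k (binom a) m + shift 1 (convBinom k (binom a)) m
    ≡⟨ cong₂ _+_ (vandermonde k a m) (shift-cong 1 m (vandermonde k a)) ⟩
  binom (a + k) m + shift 1 (binom (a + k)) m
    ≡⟨ sym (binom-suc (a + k) m) ⟩
  binom (suc (a + k)) m
    ≡⟨ cong (λ e → binom e m) (sym (ℕₚ.+-suc a k)) ⟩
  binom (a + suc k) m ∎
  where
  open ≡-Reasoning
  drop-top : convBinom k (binom a) m + binom k (suc k) * shift (suc k) (binom a) m ≡ convBinom k (binom a) m
  drop-top = trans (cong (λ b → convBinom k (binom a) m + b * shift (suc k) (binom a) m) (n<k⇒binom≡0 (ℕₚ.n<1+n k)))
                   (ℕₚ.+-identityʳ _)
  drop-bottom : ∑< (suc (suc k)) (λ x → shift 1 (binom k) x * shift x (binom a) m) ≡ convBinom k (shift 1 (binom a)) m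
  drop-bottom = ∑<-cong (suc k) (λ x _ → cong (binom k x *_) (trans (cong (λ e → shift e (binom a) m) (ℕₚ.+-comm 1 x)) (sym (shift-shift x 1 (binom a) m))))

-- Adding one coordinate x ∈ {0,…,k}: it is weighted by binom k x and raises the coordinate sum
-- by x; when x = 0 (resp. x = k) it may also be one of the s marked zeros (resp. t marked tops).
extend : ℕ → (ℕ → ℕ → ℕ → ℕ) → ℕ → ℕ → ℕ → ℕ
extend k F m s t =
  convBinom k (λ m′ → F m′ s t) m + shift 1 (λ s′ → F m s′ t) s + shift k (λ m′ → shift 1 (F m′ s) t) m

extend-cong : ∀ k {F G : ℕ → ℕ → ℕ → ℕ} → (∀ m s t → F m s t ≡ G m s t) →
  ∀ m s t → extend k F m s t ≡ extend k G m s t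
extend-cong k F≡G m s t =
  cong₂ _+_ (cong₂ _+_ (convBinom-cong k m (λ m′ → F≡G m′ s t)) (shift-cong 1 s (λ s′ → F≡G m s′ t)))
            (shift-cong k m (λ m′ → shift-cong 1 t (F≡G m′ s)))

trinom : ℕ → ℕ → ℕ → ℕ
trinom n s t = binom n s * binom (n ∸ s) t

trinom-suc : ∀ n s t → trinom (suc n) s t ≡ trinom n s t + shift 1 (λ s′ → trinom n s′ t) s + shift 1 (trinom n s) t
trinom-suc n zero t = begin
  1 * binom (suc n) t                            ≡⟨ cong (1 *_) (binom-suc n t) ⟩
  1 * (binom n t + shift 1 (binom n) t)          ≡⟨ ℕₚ.*-distribˡ-+ 1 (binom n t) _ ⟩
  1 * binom n t + 1 * shift 1 (binom n) t        ≡⟨ cong₂ _+_ (sym (ℕₚ.+-identityʳ _)) (sym (shift-*ˡ 1 1 (binom n) t)) ⟩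
  1 * binom n t + 0 + shift 1 (λ t′ → 1 * binom n t′) t
    ≡⟨ cong (λ b → b * binom n t + 0 + shift 1 (λ t′ → b * binom n t′) t) (sym (binom[n,0]≡1 n)) ⟩
  trinom n 0 t + 0 + shift 1 (trinom n 0) t      ∎
  where open ≡-Reasoning
trinom-suc n (suc s) t with s ℕₚ.<? n
... | yes s<n = begin
  (binom n s + binom n (suc s)) * binom (n ∸ s) t
    ≡⟨ cong (λ e → (binom n s + binom n (suc s)) * binom e t) (ℕₚ.+-∸-assoc 1 s<n) ⟩
  (binom n s + binom n (suc s)) * binom (suc r) t
    ≡⟨ cong ((binom n s + binom n (suc s)) *_) (binom-suc r t) ⟩
  (binom n s + binom n (suc s)) * (binom r t + shift 1 (binom r) t)
    ≡⟨ solve 4 (λ a b x y → (a :+ b) :* (x :+ y) := b :* x :+ a :* (x :+ y) :+ b :* y) refl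
         (binom n s) (binom n (suc s)) (binom r t) (shift 1 (binom r) t) ⟩
  binom n (suc s) * binom r t + binom n s * (binom r t + shift 1 (binom r) t) + binom n (suc s) * shift 1 (binom r) t
    ≡⟨ cong₂ (λ e f → binom n (suc s) * binom r t + binom n s * e + f)
         (trans (sym (binom-suc r t)) (cong (λ e → binom e t) (sym (ℕₚ.+-∸-assoc 1 s<n))))
         (sym (shift-*ˡ 1 (binom n (suc s)) (binom r) t)) ⟩
  trinom n (suc s) t + trinom n s t + shift 1 (trinom n (suc s)) t ∎
  where
  open ≡-Reasoning
  r = n ∸ suc s
... | no s≮n = begin
  (binom n s + binom n (suc s)) * binom (n ∸ s) t
    ≡⟨ cong (λ b → (binom n s + b) * binom (n ∸ s) t) top≡0 ⟩
  (binom n s + 0) * binom (n ∸ s) t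
    ≡⟨ cong (_* binom (n ∸ s) t) (ℕₚ.+-identityʳ (binom n s)) ⟩
  binom n s * binom (n ∸ s) t
    ≡⟨ sym (ℕₚ.+-identityʳ _) ⟩
  binom n s * binom (n ∸ s) t + 0
    ≡⟨ cong₂ (λ b e → b * binom (n ∸ suc s) t + binom n s * binom (n ∸ s) t + e) (sym top≡0)
         (sym (trans (shift-cong 1 t (λ t′ → cong (_* binom (n ∸ suc s) t′) top≡0)) (shift-zero 1 t))) ⟩
  trinom n (suc s) t + trinom n s t + shift 1 (trinom n (suc s)) t ∎
  where
  open ≡-Reasoning
  top≡0 : binom n (suc s) ≡ 0
  top≡0 = n<k⇒binom≡0 (s≤s (ℕₚ.≮⇒≥ s≮n))

n<s+t⇒trinom≡0 : ∀ {n s t} → n < s + t → trinom n s t ≡ 0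
n<s+t⇒trinom≡0 {n} {s} {t} n<s+t with s ℕₚ.≤? n
... | yes s≤n = trans (cong (binom n s *_) (n<k⇒binom≡0 (subst (n ∸ s <_) (ℕₚ.m+n∸m≡n s t) (ℕₚ.∸-monoˡ-< n<s+t s≤n)))) (ℕₚ.*-zeroʳ (binom n s))
... | no  s≰n = cong (_* binom (n ∸ s) t) (n<k⇒binom≡0 (ℕₚ.≰⇒> s≰n))

closedCount : ℕ → ℕ → ℕ → ℕ → ℕ → ℕ
closedCount k n m s t = trinom n s t * shift (t * k) (binom ((n ∸ (s + t)) * k)) m

closedCount-suc : ∀ k n m s t → closedCount k (suc n) m s t ≡ extend k (closedCount k n) m s t
closedCount-suc k n m s t = sym (begin
  extend k (closedCount k n) m s t
    ≡⟨ cong₂ _+_ (cong₂ _+_ unmarked (marked-zero s)) (marked-top t) ⟩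
  trinom n s t * A + shift 1 (λ s′ → trinom n s′ t) s * A + shift 1 (trinom n s) t * A
    ≡⟨ solve 4 (λ a b c x → a :* x :+ b :* x :+ c :* x := (a :+ b :+ c) :* x) refl
         (trinom n s t) (shift 1 (λ s′ → trinom n s′ t) s) (shift 1 (trinom n s) t) A ⟩
  (trinom n s t + shift 1 (λ s′ → trinom n s′ t) s + shift 1 (trinom n s) t) * A
    ≡⟨ cong (_* A) (sym (trinom-suc n s t)) ⟩
  closedCount k (suc n) m s t ∎)
  where
  open ≡-Reasoning
  A = shift (t * k) (binom ((suc n ∸ (s + t)) * k)) m
  unmarked : convBinom k (λ m′ → closedCount k n m′ s t) m ≡ trinom n s t * A
  unmarked with s + t ℕₚ.≤? n
  ... | no s+t≰n = trans (convBinom-cong k m (λ m′ → cong (_* shift (t * k) (binom ((n ∸ (s + t)) * k)) m′) (n<s+t⇒trinom≡0 (ℕₚ.≰⇒> s+t≰n))))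
                         (trans (convBinom-*ˡ k 0 (shift (t * k) (binom ((n ∸ (s + t)) * k))) m)
                                (cong (_* A) (sym (n<s+t⇒trinom≡0 (ℕₚ.≰⇒> s+t≰n)))))
  ... | yes s+t≤n = begin
    convBinom k (λ m′ → trinom n s t * shift (t * k) (binom (r * k)) m′) m
      ≡⟨ convBinom-*ˡ k (trinom n s t) (shift (t * k) (binom (r * k))) m ⟩
    trinom n s t * convBinom k (shift (t * k) (binom (r * k))) m
      ≡⟨ cong (trinom n s t *_) (convBinom-shift k (t * k) (binom (r * k)) m) ⟩
    trinom n s t * shift (t * k) (convBinom k (binom (r * k))) m
      ≡⟨ cong (trinom n s t *_) (shift-cong (t * k) m (vandermonde k (r * k))) ⟩
    trinom n s t * shift (t * k) (binom (r * k + k)) m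
      ≡⟨ cong (λ e → trinom n s t * shift (t * k) (binom e) m) (ℕₚ.+-comm (r * k) k) ⟩
    trinom n s t * shift (t * k) (binom (suc r * k)) m
      ≡⟨ cong (λ e → trinom n s t * shift (t * k) (binom (e * k)) m) (sym (ℕₚ.+-∸-assoc 1 s+t≤n)) ⟩
    trinom n s t * A ∎
    where r = n ∸ (s + t)
  marked-zero : ∀ s → shift 1 (λ s′ → closedCount k n m s′ t) s ≡ shift 1 (λ s′ → trinom n s′ t) s * shift (t * k) (binom ((suc n ∸ (s + t)) * k)) m
  marked-zero zero    = refl
  marked-zero (suc s) = refl
  marked-top : ∀ t → shift k (λ m′ → shift 1 (closedCount k n m′ s) t) m ≡ shift 1 (trinom n s) t * shift (t * k) (binom ((suc n ∸ (s + t)) * k)) m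
  marked-top zero    = shift-zero k m
  marked-top (suc t) = begin
    shift k (λ m′ → trinom n s t * shift (t * k) (binom ((n ∸ (s + t)) * k)) m′) m
      ≡⟨ shift-*ˡ k (trinom n s t) (shift (t * k) (binom ((n ∸ (s + t)) * k))) m ⟩
    trinom n s t * shift k (shift (t * k) (binom ((n ∸ (s + t)) * k))) m
      ≡⟨ cong (trinom n s t *_) (shift-shift k (t * k) (binom ((n ∸ (s + t)) * k)) m) ⟩
    trinom n s t * shift (suc t * k) (binom ((suc n ∸ suc (s + t)) * k)) m
      ≡⟨ cong (λ e → trinom n s t * shift (suc t * k) (binom ((suc n ∸ e) * k)) m) (sym (ℕₚ.+-suc s t)) ⟩
    trinom n s t * shift (suc t * k) (binom ((suc n ∸ (s + suc t)) * k)) m ∎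

ind : Bool → ℕ
ind b = if b then 1 else 0

∑<-select : ∀ n {y} (f : ℕ → ℕ) → y < n → ∑< n (λ x → ind (x ≡ᵇ y) * f x) ≡ f y
∑<-select (suc n) {zero}  f _         =
  trans (cong (_+_ (f 0 + 0)) (∑<-zero n (λ _ _ → refl))) (trans (ℕₚ.+-identityʳ _) (ℕₚ.+-identityʳ (f 0)))
∑<-select (suc n) {suc y} f (s≤s y<n) = ∑<-select n (λ x → f (suc x)) y<n

ind-+≡ᵇ : ∀ x a m → ind (x + a ≡ᵇ m) ≡ shift x (λ m′ → ind (a ≡ᵇ m′)) m
ind-+≡ᵇ zero    a m       = refl
ind-+≡ᵇ (suc x) a zero    = refl
ind-+≡ᵇ (suc x) a (suc m) = ind-+≡ᵇ x a m

binom-ind+ : ∀ b a s → binom (ind b + a) s ≡ binom a s + ind b * shift 1 (binom a) s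
binom-ind+ false a s = sym (ℕₚ.+-identityʳ (binom a s))
binom-ind+ true  a s = trans (binom-suc a s) (cong (_+_ (binom a s)) (sym (ℕₚ.*-identityˡ _)))

ind≡ᵇ0*ind≡ᵇk : ∀ {k} → 0 < k → ∀ x → ind (x ≡ᵇ 0) * ind (x ≡ᵇ k) ≡ 0
ind≡ᵇ0*ind≡ᵇk {suc k} _ zero    = refl
ind≡ᵇ0*ind≡ᵇk {suc k} _ (suc x) = refl

module MarkedCount (k : ℕ) where

  zeros tops : ∀ {n} → Vec ℕ n → ℕ
  zeros = countEq 0
  tops  = countEq k

  -- If w sums to m: its weight ∏ binom k wᵣ times the number of ways to mark s of its zero
  -- coordinates and t of its coordinates equal to k.
  marked : ∀ {n} → Vec ℕ n → ℕ → ℕ → ℕ → ℕ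
  marked w m s t = ind (V.sum w ≡ᵇ m) * (binomProd k w * binom (zeros w) s * binom (tops w) t)

  markedCount : ℕ → ℕ → ℕ → ℕ → ℕ
  markedCount n m s t = ∑Vec k n (λ w → marked w m s t)

  marked-shiftZero : ∀ {n} (w : Vec ℕ n) m s t →
    shift 1 (λ s′ → marked w m s′ t) s ≡ ind (V.sum w ≡ᵇ m) * (binomProd k w * shift 1 (binom (zeros w)) s * binom (tops w) t)
  marked-shiftZero w m zero    t =
    sym (trans (cong (λ e → ind (V.sum w ≡ᵇ m) * (e * binom (tops w) t)) (ℕₚ.*-zeroʳ (binomProd k w))) (ℕₚ.*-zeroʳ (ind (V.sum w ≡ᵇ m))))
  marked-shiftZero w m (suc s) t = refl

  marked-shiftTop : ∀ {n} (w : Vec ℕ n) m s t →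
    shift 1 (marked w m s) t ≡ ind (V.sum w ≡ᵇ m) * (binomProd k w * binom (zeros w) s * shift 1 (binom (tops w)) t)
  marked-shiftTop w m s zero    =
    sym (trans (cong (ind (V.sum w ≡ᵇ m) *_) (ℕₚ.*-zeroʳ (binomProd k w * binom (zeros w) s))) (ℕₚ.*-zeroʳ (ind (V.sum w ≡ᵇ m))))
  marked-shiftTop w m s (suc t) = refl

  marked-∷ : 0 < k → ∀ {n} x (w : Vec ℕ n) m s t →
    marked (x ∷ w) m s t ≡
      binom k x * shift x (λ m′ → marked w m′ s t) m
      + ind (x ≡ᵇ 0) * (binom k x * shift x (λ m′ → shift 1 (λ s′ → marked w m′ s′ t) s) m)
      + ind (x ≡ᵇ k) * (binom k x * shift x (λ m′ → shift 1 (marked w m′ s) t) m)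
  marked-∷ k>0 x w m s t = begin
    ind (x + V.sum w ≡ᵇ m) * ((k C x) * p * binom (e₀ + zeros w) s * binom (eₖ + tops w) t)
      ≡⟨ cong₂ (λ i c → i * (c * p * binom (e₀ + zeros w) s * binom (eₖ + tops w) t))
           (ind-+≡ᵇ x (V.sum w) m) (sym (binom≡C k x)) ⟩
    I * (c * p * binom (e₀ + zeros w) s * binom (eₖ + tops w) t)
      ≡⟨ cong₂ (λ P R → I * (c * p * P * R)) (binom-ind+ (x ≡ᵇ 0) (zeros w) s) (binom-ind+ (x ≡ᵇ k) (tops w) t) ⟩
    I * (c * p * (P + e₀ * Q) * (R + eₖ * S))
      ≡⟨ solve 9 (λ I c p P Q R S e₀ eₖ →
             I :* (c :* p :* (P :+ e₀ :* Q) :* (R :+ eₖ :* S))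
           := c :* (I :* (p :* P :* R)) :+ e₀ :* (c :* (I :* (p :* Q :* R))) :+ eₖ :* (c :* (I :* (p :* P :* S)))
              :+ e₀ :* eₖ :* (c :* I :* p :* Q :* S)) refl I c p P Q R S e₀ eₖ ⟩
    c * (I * (p * P * R)) + e₀ * (c * (I * (p * Q * R))) + eₖ * (c * (I * (p * P * S))) + e₀ * eₖ * (c * I * p * Q * S)
      ≡⟨ cong (λ z → c * (I * (p * P * R)) + e₀ * (c * (I * (p * Q * R))) + eₖ * (c * (I * (p * P * S))) + z * (c * I * p * Q * S))
           (ind≡ᵇ0*ind≡ᵇk k>0 x) ⟩
    c * (I * (p * P * R)) + e₀ * (c * (I * (p * Q * R))) + eₖ * (c * (I * (p * P * S))) + 0
      ≡⟨ ℕₚ.+-identityʳ _ ⟩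
    c * (I * (p * P * R)) + e₀ * (c * (I * (p * Q * R))) + eₖ * (c * (I * (p * P * S)))
      ≡⟨ cong₂ _+_ (cong₂ _+_ (cong (c *_) (into-shift (p * P * R) (λ m′ → refl)))
                              (cong (λ z → e₀ * (c * z)) (into-shift (p * Q * R) (λ m′ → sym (marked-shiftZero w m′ s t)))))
                   (cong (λ z → eₖ * (c * z)) (into-shift (p * P * S) (λ m′ → sym (marked-shiftTop w m′ s t)))) ⟩
    c * shift x (λ m′ → marked w m′ s t) m
      + e₀ * (c * shift x (λ m′ → shift 1 (λ s′ → marked w m′ s′ t) s) m)
      + eₖ * (c * shift x (λ m′ → shift 1 (marked w m′ s) t) m) ∎
    where
    open ≡-Reasoning
    p = binomProd k w
    c = binom k x
    e₀ = ind (x ≡ᵇ 0)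
    eₖ = ind (x ≡ᵇ k)
    I = shift x (λ m′ → ind (V.sum w ≡ᵇ m′)) m
    P = binom (zeros w) s
    Q = shift 1 (binom (zeros w)) s
    R = binom (tops w) t
    S = shift 1 (binom (tops w)) t
    into-shift : ∀ a {g : ℕ → ℕ} → (∀ m′ → ind (V.sum w ≡ᵇ m′) * a ≡ g m′) → I * a ≡ shift x g m
    into-shift a eq = trans (sym (shift-*ʳ x a (λ m′ → ind (V.sum w ≡ᵇ m′)) m)) (shift-cong x m eq)

  ∑Vec-shift : ∀ n c (G : Vec ℕ n → ℕ → ℕ) m →
    ∑Vec k n (λ w → shift c (G w) m) ≡ shift c (λ y → ∑Vec k n (λ w → G w y)) m
  ∑Vec-shift n c G m = sym (shift-natural (∑Vec k n) (∑Vec-zero k n) c G m)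

  ∑Vec-binom*shift : ∀ n x (G : Vec ℕ n → ℕ → ℕ) m →
    ∑Vec k n (λ w → binom k x * shift x (G w) m) ≡ binom k x * shift x (λ y → ∑Vec k n (λ w → G w y)) m
  ∑Vec-binom*shift n x G m =
    trans (∑Vec-distribˡ-* k n (binom k x) (λ w → shift x (G w) m)) (cong (binom k x *_) (∑Vec-shift n x G m))

  ∑Vec-marked-∷ : 0 < k → ∀ n x m s t →
    ∑Vec k n (λ w → marked (x ∷ w) m s t) ≡
      binom k x * shift x (λ m′ → markedCount n m′ s t) m
      + ind (x ≡ᵇ 0) * (binom k x * shift x (λ m′ → shift 1 (λ s′ → markedCount n m′ s′ t) s) m)
      + ind (x ≡ᵇ k) * (binom k x * shift x (λ m′ → shift 1 (markedCount n m′ s) t) m)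
  ∑Vec-marked-∷ k>0 n x m s t = begin
    ∑Vec k n (λ w → marked (x ∷ w) m s t)
      ≡⟨ ∑Vec-cong k n (λ w → marked-∷ k>0 x w m s t) ⟩
    ∑Vec k n (λ w → a₀ w + ind (x ≡ᵇ 0) * a₁ w + ind (x ≡ᵇ k) * a₂ w)
      ≡⟨ trans (∑Vec-distrib-+ k n (λ w → a₀ w + ind (x ≡ᵇ 0) * a₁ w) (λ w → ind (x ≡ᵇ k) * a₂ w))
               (cong (_+ ∑Vec k n (λ w → ind (x ≡ᵇ k) * a₂ w)) (∑Vec-distrib-+ k n a₀ (λ w → ind (x ≡ᵇ 0) * a₁ w))) ⟩
    ∑Vec k n a₀ + ∑Vec k n (λ w → ind (x ≡ᵇ 0) * a₁ w) + ∑Vec k n (λ w → ind (x ≡ᵇ k) * a₂ w)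
      ≡⟨ cong₂ _+_ (cong₂ _+_ (∑Vec-binom*shift n x (λ w m′ → marked w m′ s t) m)
                              (indicated (x ≡ᵇ 0) (λ w m′ → shift 1 (λ s′ → marked w m′ s′ t) s)
                                 (λ m′ → ∑Vec-shift n 1 (λ w s′ → marked w m′ s′ t) s)))
                   (indicated (x ≡ᵇ k) (λ w m′ → shift 1 (marked w m′ s) t)
                      (λ m′ → ∑Vec-shift n 1 (λ w → marked w m′ s) t)) ⟩
    binom k x * shift x (λ m′ → markedCount n m′ s t) m
      + ind (x ≡ᵇ 0) * (binom k x * shift x (λ m′ → shift 1 (λ s′ → markedCount n m′ s′ t) s) m)
      + ind (x ≡ᵇ k) * (binom k x * shift x (λ m′ → shift 1 (markedCount n m′ s) t) m) ∎
    where
    open ≡-Reasoning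
    a₀ a₁ a₂ : Vec ℕ n → ℕ
    a₀ w = binom k x * shift x (λ m′ → marked w m′ s t) m
    a₁ w = binom k x * shift x (λ m′ → shift 1 (λ s′ → marked w m′ s′ t) s) m
    a₂ w = binom k x * shift x (λ m′ → shift 1 (marked w m′ s) t) m
    indicated : ∀ b (G : Vec ℕ n → ℕ → ℕ) {H : ℕ → ℕ} → (∀ m′ → ∑Vec k n (λ w → G w m′) ≡ H m′) →
      ∑Vec k n (λ w → ind b * (binom k x * shift x (G w) m)) ≡ ind b * (binom k x * shift x H m)
    indicated b G ∑G≡H = trans (∑Vec-distribˡ-* k n (ind b) (λ w → binom k x * shift x (G w) m))
      (cong (ind b *_) (trans (∑Vec-binom*shift n x G m) (cong (binom k x *_) (shift-cong x m ∑G≡H))))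

  markedCount-suc : 0 < k → ∀ n m s t → markedCount (suc n) m s t ≡ extend k (markedCount n) m s t
  markedCount-suc k>0 n m s t = begin
    ∑< (suc k) (λ x → ∑Vec k n (λ w → marked (x ∷ w) m s t))
      ≡⟨ ∑<-cong (suc k) (λ x _ → ∑Vec-marked-∷ k>0 n x m s t) ⟩
    ∑< (suc k) (λ x → T₀ x + ind (x ≡ᵇ 0) * T₁ x + ind (x ≡ᵇ k) * T₂ x)
      ≡⟨ trans (∑<-distrib-+ (suc k) (λ x → T₀ x + ind (x ≡ᵇ 0) * T₁ x) (λ x → ind (x ≡ᵇ k) * T₂ x))
               (cong (_+ ∑< (suc k) (λ x → ind (x ≡ᵇ k) * T₂ x)) (∑<-distrib-+ (suc k) T₀ (λ x → ind (x ≡ᵇ 0) * T₁ x))) ⟩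
    convBinom k (λ m′ → markedCount n m′ s t) m + ∑< (suc k) (λ x → ind (x ≡ᵇ 0) * T₁ x) + ∑< (suc k) (λ x → ind (x ≡ᵇ k) * T₂ x)
      ≡⟨ cong₂ (λ a b → convBinom k (λ m′ → markedCount n m′ s t) m + a + b)
           (∑<-select (suc k) T₁ (s≤s z≤n)) (∑<-select (suc k) T₂ (ℕₚ.n<1+n k)) ⟩
    convBinom k (λ m′ → markedCount n m′ s t) m + T₁ 0 + T₂ k
      ≡⟨ cong₂ (λ a b → convBinom k (λ m′ → markedCount n m′ s t) m + a + b)
           (trans (cong (_* shift 1 (λ s′ → markedCount n m s′ t) s) (binom[n,0]≡1 k)) (ℕₚ.*-identityˡ _))
           (trans (cong (_* shift k (λ m′ → shift 1 (markedCount n m′ s) t) m) (binom[n,n]≡1 k)) (ℕₚ.*-identityˡ _)) ⟩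
    extend k (markedCount n) m s t ∎
    where
    open ≡-Reasoning
    T₀ T₁ T₂ : ℕ → ℕ
    T₀ x = binom k x * shift x (λ m′ → markedCount n m′ s t) m
    T₁ x = binom k x * shift x (λ m′ → shift 1 (λ s′ → markedCount n m′ s′ t) s) m
    T₂ x = binom k x * shift x (λ m′ → shift 1 (markedCount n m′ s) t) m

  markedCount-zero : ∀ m s t → markedCount 0 m s t ≡ closedCount k 0 m s t
  markedCount-zero m       (suc s) t       = ℕₚ.*-zeroʳ (ind (0 ≡ᵇ m))
  markedCount-zero m       zero    (suc t) = ℕₚ.*-zeroʳ (ind (0 ≡ᵇ m))
  markedCount-zero zero    zero    zero    = refl
  markedCount-zero (suc m) zero    zero    = refl

  markedCount≡closedCount : 0 < k → ∀ n m s t → markedCount n m s t ≡ closedCount k n m s t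
  markedCount≡closedCount k>0 zero    m s t = markedCount-zero m s t
  markedCount≡closedCount k>0 (suc n) m s t =
    trans (markedCount-suc k>0 n m s t)
          (trans (extend-cong k (markedCount≡closedCount k>0 n) m s t) (sym (closedCount-suc k n m s t)))

sign-suc : ∀ n → sign (suc n) ≡ ℤ.- sign n
sign-suc zero          = refl
sign-suc (suc zero)    = refl
sign-suc (suc (suc n)) = sign-suc n

sign-+ : ∀ a b → sign (a + b) ≡ sign a ℤ.* sign b
sign-+ zero          b = sym (ℤₚ.*-identityˡ (sign b))
sign-+ (suc zero)    b = trans (sign-suc b) (sym (ℤₚ.-1*i≡-i (sign b)))
sign-+ (suc (suc a)) b = sign-+ a b

sign*sign≡1 : ∀ a → sign a ℤ.* sign a ≡ ℤ.+ 1
sign*sign≡1 zero          = refl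
sign*sign≡1 (suc zero)    = refl
sign*sign≡1 (suc (suc a)) = sign*sign≡1 a

sign-∸ : ∀ {i s} → i ≤ s → sign (i + s) ≡ sign (s ∸ i)
sign-∸ {i} {s} i≤s = begin
  sign (i + s)                              ≡⟨ cong (λ e → sign (i + e)) (sym (ℕₚ.m+[n∸m]≡n i≤s)) ⟩
  sign (i + (i + (s ∸ i)))                  ≡⟨ trans (cong (λ e → sign e) (sym (ℕₚ.+-assoc i i (s ∸ i)))) (sign-+ (i + i) (s ∸ i)) ⟩
  sign (i + i) ℤ.* sign (s ∸ i)             ≡⟨ cong (ℤ._* sign (s ∸ i)) (trans (sign-+ i i) (sign*sign≡1 i)) ⟩
  ℤ.+ 1 ℤ.* sign (s ∸ i)                    ≡⟨ ℤₚ.*-identityˡ (sign (s ∸ i)) ⟩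
  sign (s ∸ i)                              ∎
  where open ≡-Reasoning

alternating : ℕ → ℕ → ℤ
alternating a i = ℤΣ.∑< (suc a) (λ s → sign s ℤ.* (+ binom s i ℤ.* + binom a s))

-- Pascal's rule in a and then in s makes the sum telescope.
alternating-suc : ∀ a i →
  alternating (suc a) i ≡ ℤ.- ℤΣ.∑< (suc a) (λ s → sign s ℤ.* (+ shift 1 (binom s) i ℤ.* + binom a s))
alternating-suc a i = begin
  ℤΣ.∑< (suc (suc a)) (λ s → sign s ℤ.* (+ binom s i ℤ.* + binom (suc a) s))
    ≡⟨ ℤΣ.∑<-cong (suc (suc a)) (λ s _ → pascal-a s) ⟩
  ℤΣ.∑< (suc (suc a)) (λ s → f s ℤ.+ g s)
    ≡⟨ ℤΣ.∑<-distrib-+ (suc (suc a)) f g ⟩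
  ℤΣ.∑< (suc (suc a)) f ℤ.+ (g 0 ℤ.+ ℤΣ.∑< (suc a) (λ s → g (suc s)))
    ≡⟨ cong₂ ℤ._+_ (trans (ℤΣ.∑<-last (suc a) f) (cong (ℤ._+_ (alternating a i)) f-top))
                    (cong₂ ℤ._+_ g-bottom (trans (ℤΣ.∑<-cong (suc a) (λ s _ → pascal-s s))
                                                 (ℤΣ.∑<-distrib-+ (suc a) (λ s → ℤ.- f s) (λ s → ℤ.- h s)))) ⟩
  alternating a i ℤ.+ ℤ.+ 0 ℤ.+ (ℤ.+ 0 ℤ.+ (ℤΣ.∑< (suc a) (λ s → ℤ.- f s) ℤ.+ ℤΣ.∑< (suc a) (λ s → ℤ.- h s)))
    ≡⟨ cong₂ (λ x y → alternating a i ℤ.+ ℤ.+ 0 ℤ.+ (ℤ.+ 0 ℤ.+ (x ℤ.+ y)))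
         (∑<-neg f) (∑<-neg h) ⟩
  alternating a i ℤ.+ ℤ.+ 0 ℤ.+ (ℤ.+ 0 ℤ.+ (ℤ.- alternating a i ℤ.+ ℤ.- ℤΣ.∑< (suc a) h))
    ≡⟨ cancel (alternating a i) (ℤΣ.∑< (suc a) h) ⟩
  ℤ.- ℤΣ.∑< (suc a) h ∎
  where
  open ≡-Reasoning
  f g h : ℕ → ℤ
  f s = sign s ℤ.* (+ binom s i ℤ.* + binom a s)
  g s = sign s ℤ.* (+ binom s i ℤ.* + shift 1 (binom a) s)
  h s = sign s ℤ.* (+ shift 1 (binom s) i ℤ.* + binom a s)
  ∑<-neg : ∀ u → ℤΣ.∑< (suc a) (λ s → ℤ.- u s) ≡ ℤ.- ℤΣ.∑< (suc a) u
  ∑<-neg u = trans (ℤΣ.∑<-cong (suc a) (λ s _ → sym (ℤₚ.-1*i≡-i (u s))))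
                   (trans (ℤΣ.∑<-distribˡ-* (suc a) ℤ.-1ℤ u) (ℤₚ.-1*i≡-i _))
  split : ∀ x y z w → x ℤ.* (y ℤ.* (z ℤ.+ w)) ≡ x ℤ.* (y ℤ.* z) ℤ.+ x ℤ.* (y ℤ.* w)
  split = ℤ-Solver.solve-∀
  pascal-a : ∀ s → sign s ℤ.* (+ binom s i ℤ.* + binom (suc a) s) ≡ f s ℤ.+ g s
  pascal-a s = trans (cong (λ e → sign s ℤ.* (+ binom s i ℤ.* e)) (trans (cong +_ (binom-suc a s)) (ℤₚ.pos-+ (binom a s) (shift 1 (binom a) s))))
                     (split (sign s) (+ binom s i) (+ binom a s) (+ shift 1 (binom a) s))
  split-neg : ∀ x y z w → ℤ.- x ℤ.* ((y ℤ.+ z) ℤ.* w) ≡ ℤ.- (x ℤ.* (y ℤ.* w)) ℤ.+ ℤ.- (x ℤ.* (z ℤ.* w))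
  split-neg = ℤ-Solver.solve-∀
  pascal-s : ∀ s → g (suc s) ≡ ℤ.- f s ℤ.+ ℤ.- h s
  pascal-s s = trans (cong₂ (λ σ e → σ ℤ.* (e ℤ.* + binom a s)) (sign-suc s) (trans (cong +_ (binom-suc s i)) (ℤₚ.pos-+ (binom s i) (shift 1 (binom s) i))))
                     (split-neg (sign s) (+ binom s i) (+ shift 1 (binom s) i) (+ binom a s))
  f-top : f (suc a) ≡ ℤ.+ 0
  f-top = trans (cong (λ e → sign (suc a) ℤ.* (+ binom (suc a) i ℤ.* + e)) (n<k⇒binom≡0 (ℕₚ.n<1+n a)))
                (trans (cong (sign (suc a) ℤ.*_) (ℤₚ.*-zeroʳ (+ binom (suc a) i))) (ℤₚ.*-zeroʳ (sign (suc a))))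
  g-bottom : g 0 ≡ ℤ.+ 0
  g-bottom = trans (cong (ℤ.+ 1 ℤ.*_) (ℤₚ.*-zeroʳ (+ binom 0 i))) refl
  cancel : ∀ x y → x ℤ.+ ℤ.+ 0 ℤ.+ (ℤ.+ 0 ℤ.+ (ℤ.- x ℤ.+ ℤ.- y)) ≡ ℤ.- y
  cancel = ℤ-Solver.solve-∀

alternating≡ : ∀ a i → alternating a i ≡ sign a ℤ.* + ind (a ≡ᵇ i)
alternating≡ zero zero    = refl
alternating≡ zero (suc i) = refl
alternating≡ (suc a) zero = trans (alternating-suc a 0)
  (trans (cong ℤ.-_ (ℤΣ.∑<-zero (suc a) {λ s → sign s ℤ.* (+ 0 ℤ.* + binom a s)}
                      (λ s _ → trans (cong (sign s ℤ.*_) (ℤₚ.*-zeroˡ (+ binom a s))) (ℤₚ.*-zeroʳ (sign s)))))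
         (sym (ℤₚ.*-zeroʳ (sign (suc a)))))
alternating≡ (suc a) (suc i) = begin
  alternating (suc a) (suc i)                ≡⟨ alternating-suc a (suc i) ⟩
  ℤ.- alternating a i                        ≡⟨ cong ℤ.-_ (alternating≡ a i) ⟩
  ℤ.- (sign a ℤ.* + ind (a ≡ᵇ i))            ≡⟨ ℤₚ.neg-distribˡ-* (sign a) _ ⟩
  ℤ.- sign a ℤ.* + ind (a ≡ᵇ i)              ≡⟨ cong (ℤ._* + ind (a ≡ᵇ i)) (sym (sign-suc a)) ⟩
  sign (suc a) ℤ.* + ind (a ≡ᵇ i)            ∎
  where open ≡-Reasoning

inversionCoeff : ℕ → ℕ → ℤ
inversionCoeff i s = sign (i + s) ℤ.* + binom s i

binomialInversion : ∀ {a N} i → a ≤ N →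
  + ind (a ≡ᵇ i) ≡ ℤΣ.∑< (suc N) (λ s → inversionCoeff i s ℤ.* + binom a s)
binomialInversion {a} {N} i a≤N = sym (begin
  ℤΣ.∑< (suc N) (λ s → inversionCoeff i s ℤ.* + binom a s)
    ≡⟨ ℤΣ.∑<-cong (suc N) (λ s _ → regroup s) ⟩
  ℤΣ.∑< (suc N) (λ s → sign i ℤ.* f s)
    ≡⟨ ℤΣ.∑<-distribˡ-* (suc N) (sign i) f ⟩
  sign i ℤ.* ℤΣ.∑< (suc N) f
    ≡⟨ cong (sign i ℤ.*_) (ℤΣ.∑<-restrict f z≤n a≤N (λ _ ()) f-vanishes) ⟩
  sign i ℤ.* alternating a i
    ≡⟨ cong (sign i ℤ.*_) (alternating≡ a i) ⟩
  sign i ℤ.* (sign a ℤ.* + ind (a ≡ᵇ i))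
    ≡⟨ signs-cancel (a ≡ᵇ i) refl ⟩
  + ind (a ≡ᵇ i) ∎)
  where
  open ≡-Reasoning
  f : ℕ → ℤ
  f s = sign s ℤ.* (+ binom s i ℤ.* + binom a s)
  reassoc : ∀ x y u v → x ℤ.* y ℤ.* u ℤ.* v ≡ x ℤ.* (y ℤ.* (u ℤ.* v))
  reassoc = ℤ-Solver.solve-∀
  regroup : ∀ s → inversionCoeff i s ℤ.* + binom a s ≡ sign i ℤ.* f s
  regroup s = trans (cong (λ σ → σ ℤ.* + binom s i ℤ.* + binom a s) (sign-+ i s))
                    (reassoc (sign i) (sign s) (+ binom s i) (+ binom a s))
  f-vanishes : ∀ s → a < s → f s ≡ ℤ.+ 0
  f-vanishes s a<s = trans (cong (λ e → sign s ℤ.* (+ binom s i ℤ.* + e)) (n<k⇒binom≡0 a<s))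
                           (trans (cong (sign s ℤ.*_) (ℤₚ.*-zeroʳ (+ binom s i))) (ℤₚ.*-zeroʳ (sign s)))
  signs-cancel : ∀ b → (a ≡ᵇ i) ≡ b → sign i ℤ.* (sign a ℤ.* + ind b) ≡ + ind b
  signs-cancel false _ = trans (cong (sign i ℤ.*_) (ℤₚ.*-zeroʳ (sign a))) (ℤₚ.*-zeroʳ (sign i))
  signs-cancel true  a≡ᵇi with ℕₚ.≡ᵇ⇒≡ a i (subst T (sym a≡ᵇi) tt)
  ... | refl = trans (sym (ℤₚ.*-assoc (sign a) (sign a) (+ 1))) (cong (ℤ._* + 1) (sign*sign≡1 a))

sum-concatMap : ∀ {A B : Set} (f : B → ℕ) (g : A → List B) xs →
  sum (map f (concatMap g xs)) ≡ sum (map (λ x → sum (map f (g x))) xs)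
sum-concatMap f g []       = refl
sum-concatMap f g (x ∷ xs) = begin
  sum (map f (g x ++ concatMap g xs))                 ≡⟨ cong sum (List.map-++ f (g x) (concatMap g xs)) ⟩
  sum (map f (g x) ++ map f (concatMap g xs))         ≡⟨ sum-++ (map f (g x)) (map f (concatMap g xs)) ⟩
  sum (map f (g x)) + sum (map f (concatMap g xs))         ≡⟨ cong (_+_ (sum (map f (g x)))) (sum-concatMap f g xs) ⟩
  sum (map f (g x)) + sum (map (λ y → sum (map f (g y))) xs) ∎
  where open ≡-Reasoning

sum-boundedVecs : ∀ k n (f : Vec ℕ n → ℕ) → sum (map f (boundedVecs n k)) ≡ ∑Vec k n f
sum-boundedVecs k zero    f = ℕₚ.+-identityʳ (f [])
sum-boundedVecs k (suc n) f = begin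
  sum (map f (concatMap (λ x → map (x ∷_) (boundedVecs n k)) (upTo (suc k))))
    ≡⟨ sum-concatMap f (λ x → map (x ∷_) (boundedVecs n k)) (upTo (suc k)) ⟩
  sum (map (λ x → sum (map f (map (x ∷_) (boundedVecs n k)))) (upTo (suc k)))
    ≡⟨ cong sum (List.map-cong (λ x → trans (cong sum (sym (List.map-∘ (boundedVecs n k))))
                                           (sum-boundedVecs k n (λ w → f (x ∷ w)))) (upTo (suc k))) ⟩
  sum (map (λ x → ∑Vec k n (λ w → f (x ∷ w))) (upTo (suc k)))
    ≡⟨ cong sum (List.map-applyUpTo (λ x → x) (λ x → ∑Vec k n (λ w → f (x ∷ w))) (suc k)) ⟩
  sum (applyUpTo (λ x → ∑Vec k n (λ w → f (x ∷ w))) (suc k))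
    ≡⟨ foldr-applyUpTo (suc k) (λ x → ∑Vec k n (λ w → f (x ∷ w))) ⟩
  ∑Vec k (suc n) f ∎
  where open ≡-Reasoning

+-∑< : ∀ n (f : ℕ → ℕ) → + ∑< n f ≡ ℤΣ.∑< n (λ x → + f x)
+-∑< zero    f = refl
+-∑< (suc n) f = trans (ℤₚ.pos-+ (f 0) (∑< n (λ x → f (suc x)))) (cong (ℤ._+_ (+ f 0)) (+-∑< n (λ x → f (suc x))))

+-∑Vec : ∀ k n (f : Vec ℕ n → ℕ) → + ∑Vec k n f ≡ ℤΣ.∑Vec k n (λ v → + f v)
+-∑Vec k zero    f = refl
+-∑Vec k (suc n) f = trans (+-∑< (suc k) (λ x → ∑Vec k n (λ w → f (x ∷ w))))
                          (ℤΣ.∑<-cong (suc k) (λ x _ → +-∑Vec k n (λ w → f (x ∷ w))))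

countEq≤length : ∀ {n} c (v : Vec ℕ n) → countEq c v ≤ n
countEq≤length c []      = z≤n
countEq≤length c (x ∷ v) with x ≡ᵇ c
... | true  = s≤s (countEq≤length c v)
... | false = ℕₚ.m≤n⇒m≤1+n (countEq≤length c v)

if-∧-∧ : ∀ a b c x → (if a ∧ b ∧ c then x else 0) ≡ ind a * x * ind b * ind c
if-∧-∧ false b     c     x = refl
if-∧-∧ true  false c     x = sym (cong (_* ind c) (ℕₚ.*-zeroʳ (1 * x)))
if-∧-∧ true  true  false x = sym (ℕₚ.*-zeroʳ (1 * x * 1))
if-∧-∧ true  true  true  x = sym (trans (ℕₚ.*-identityʳ (1 * x * 1)) (trans (ℕₚ.*-identityʳ (1 * x)) (ℕₚ.*-identityˡ x)))

+-distrib-*³ : ∀ a b c d → + (a * (b * c * d)) ≡ + a ℤ.* (+ b ℤ.* + c ℤ.* + d)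
+-distrib-*³ a b c d = trans (ℤₚ.pos-* a (b * c * d))
  (cong (+ a ℤ.*_) (trans (ℤₚ.pos-* (b * c) d) (cong (ℤ._* + d) (ℤₚ.pos-* b c))))

module _ (k d i j p : ℕ) where
  open MarkedCount k

  private
    N = 2 * d
    inClassValue : Vec ℕ N → ℕ
    inClassValue v = if inClass p k i j v then binomProd k v else 0

    inClassValue-inverted : ∀ v → + inClassValue v ≡
      ℤΣ.∑< (suc N) (λ s → ℤΣ.∑< (suc N) (λ t → inversionCoeff i s ℤ.* inversionCoeff j t ℤ.* + marked v p s t))
    inClassValue-inverted v = begin
      + inClassValue v
        ≡⟨ cong +_ (if-∧-∧ (V.sum v ≡ᵇ p) (zeros v ≡ᵇ i) (tops v ≡ᵇ j) (binomProd k v)) ⟩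
      + (I * bp * ind (zeros v ≡ᵇ i) * ind (tops v ≡ᵇ j))
        ≡⟨ trans (ℤₚ.pos-* (I * bp * ind (zeros v ≡ᵇ i)) (ind (tops v ≡ᵇ j)))
                 (cong (ℤ._* + ind (tops v ≡ᵇ j)) (ℤₚ.pos-* (I * bp) (ind (zeros v ≡ᵇ i)))) ⟩
      + (I * bp) ℤ.* + ind (zeros v ≡ᵇ i) ℤ.* + ind (tops v ≡ᵇ j)
        ≡⟨ cong₂ (λ x y → + (I * bp) ℤ.* x ℤ.* y)
             (binomialInversion i (countEq≤length 0 v)) (binomialInversion j (countEq≤length k v)) ⟩
      + (I * bp) ℤ.* ℤΣ.∑< (suc N) α ℤ.* ℤΣ.∑< (suc N) β
        ≡⟨ trans (ℤₚ.*-assoc (+ (I * bp)) _ _) (cong (+ (I * bp) ℤ.*_) (ℤΣ.∑<-product (suc N) (suc N) α β)) ⟩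
      + (I * bp) ℤ.* ℤΣ.∑< (suc N) (λ s → ℤΣ.∑< (suc N) (λ t → α s ℤ.* β t))
        ≡⟨ sym (trans (ℤΣ.∑<-cong (suc N) (λ s _ → ℤΣ.∑<-distribˡ-* (suc N) (+ (I * bp)) (λ t → α s ℤ.* β t)))
                      (ℤΣ.∑<-distribˡ-* (suc N) (+ (I * bp)) (λ s → ℤΣ.∑< (suc N) (λ t → α s ℤ.* β t)))) ⟩
      ℤΣ.∑< (suc N) (λ s → ℤΣ.∑< (suc N) (λ t → + (I * bp) ℤ.* (α s ℤ.* β t)))
        ≡⟨ ℤΣ.∑<-cong (suc N) (λ s _ → ℤΣ.∑<-cong (suc N) (λ t _ → regroup s t)) ⟩
      ℤΣ.∑< (suc N) (λ s → ℤΣ.∑< (suc N) (λ t → inversionCoeff i s ℤ.* inversionCoeff j t ℤ.* + marked v p s t)) ∎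
      where
      open ≡-Reasoning
      I = ind (V.sum v ≡ᵇ p)
      bp = binomProd k v
      α β : ℕ → ℤ
      α s = inversionCoeff i s ℤ.* + binom (zeros v) s
      β t = inversionCoeff j t ℤ.* + binom (tops v) t
      ring : ∀ I b a Z c K → I ℤ.* b ℤ.* (a ℤ.* Z ℤ.* (c ℤ.* K)) ≡ a ℤ.* c ℤ.* (I ℤ.* (b ℤ.* Z ℤ.* K))
      ring = ℤ-Solver.solve-∀
      regroup : ∀ s t → + (I * bp) ℤ.* (α s ℤ.* β t) ≡ inversionCoeff i s ℤ.* inversionCoeff j t ℤ.* + marked v p s t
      regroup s t = trans (cong (ℤ._* (α s ℤ.* β t)) (ℤₚ.pos-* I bp))
        (trans (ring (+ I) (+ bp) (inversionCoeff i s) (+ binom (zeros v) s) (inversionCoeff j t) (+ binom (tops v) t))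
               (cong (inversionCoeff i s ℤ.* inversionCoeff j t ℤ.*_) (sym (+-distrib-*³ I bp (binom (zeros v) s) (binom (tops v) t)))))

  Φ-inverted : + Φ p d k i j ≡
    ℤΣ.∑< (suc N) (λ s → ℤΣ.∑< (suc N) (λ t → inversionCoeff i s ℤ.* inversionCoeff j t ℤ.* + markedCount N p s t))
  Φ-inverted = begin
    + sum (map inClassValue (boundedVecs N k))
      ≡⟨ cong +_ (sum-boundedVecs k N inClassValue) ⟩
    + ∑Vec k N inClassValue
      ≡⟨ +-∑Vec k N inClassValue ⟩
    ℤΣ.∑Vec k N (λ v → + inClassValue v)
      ≡⟨ ℤΣ.∑Vec-cong k N inClassValue-inverted ⟩
    ℤΣ.∑Vec k N (λ v → ℤΣ.∑< (suc N) (λ s → ℤΣ.∑< (suc N) (λ t → c s t ℤ.* + marked v p s t)))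
      ≡⟨ ℤΣ.∑Vec-∑<-comm k N (suc N) (λ v s → ℤΣ.∑< (suc N) (λ t → c s t ℤ.* + marked v p s t)) ⟩
    ℤΣ.∑< (suc N) (λ s → ℤΣ.∑Vec k N (λ v → ℤΣ.∑< (suc N) (λ t → c s t ℤ.* + marked v p s t)))
      ≡⟨ ℤΣ.∑<-cong (suc N) (λ s _ → ℤΣ.∑Vec-∑<-comm k N (suc N) (λ v t → c s t ℤ.* + marked v p s t)) ⟩
    ℤΣ.∑< (suc N) (λ s → ℤΣ.∑< (suc N) (λ t → ℤΣ.∑Vec k N (λ v → c s t ℤ.* + marked v p s t)))
      ≡⟨ ℤΣ.∑<-cong (suc N) (λ s _ → ℤΣ.∑<-cong (suc N) (λ t _ →
           trans (ℤΣ.∑Vec-distribˡ-* k N (c s t) (λ v → + marked v p s t))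
                 (cong (c s t ℤ.*_) (sym (+-∑Vec k N (λ v → marked v p s t)))))) ⟩
    ℤΣ.∑< (suc N) (λ s → ℤΣ.∑< (suc N) (λ t → c s t ℤ.* + markedCount N p s t)) ∎
    where
    open ≡-Reasoning
    c : ℕ → ℕ → ℤ
    c s t = inversionCoeff i s ℤ.* inversionCoeff j t

binom*factorials : ∀ {n s} → s ≤ n → binom n s * (s ! * (n ∸ s) !) ≡ n !
binom*factorials {n} {s} s≤n =
  trans (cong (_* (s ! * (n ∸ s) !)) (trans (binom≡C n s) (nCk≡n!/k![n-k]! s≤n)))
        (m/n*n≡m {{s !* (n ∸ s) !≢0}} (k![n∸k]!∣n! s≤n))

trinom*factorials : ∀ {n s t} → s + t ≤ n → trinom n s t * ((s ! * t !) * (n ∸ (s + t)) !) ≡ n !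
trinom*factorials {n} {s} {t} s+t≤n = begin
  binom n s * binom (n ∸ s) t * (s ! * t ! * (n ∸ (s + t)) !)
    ≡⟨ cong (λ e → binom n s * binom (n ∸ s) t * (s ! * t ! * e !)) (sym (ℕₚ.∸-+-assoc n s t)) ⟩
  binom n s * binom (n ∸ s) t * (s ! * t ! * (n ∸ s ∸ t) !)
    ≡⟨ solve 5 (λ a b x y z → a :* b :* (x :* y :* z) := a :* (x :* (b :* (y :* z)))) refl
         (binom n s) (binom (n ∸ s) t) (s !) (t !) ((n ∸ s ∸ t) !) ⟩
  binom n s * (s ! * (binom (n ∸ s) t * (t ! * (n ∸ s ∸ t) !)))
    ≡⟨ cong (λ e → binom n s * (s ! * e)) (binom*factorials t≤n∸s) ⟩
  binom n s * (s ! * (n ∸ s) !)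
    ≡⟨ binom*factorials (ℕₚ.m+n≤o⇒m≤o s s+t≤n) ⟩
  n ! ∎
  where
  open ≡-Reasoning
  t≤n∸s : t ≤ n ∸ s
  t≤n∸s = subst (_≤ n ∸ s) (ℕₚ.m+n∸m≡n s t) (ℕₚ.∸-monoˡ-≤ s s+t≤n)

multinom≡trinom : ∀ {n s t} → s + t ≤ n → multinom n s t ≡ trinom n s t
multinom≡trinom {n} {s} {t} s+t≤n =
  trans (/-congˡ {{nonZero}} (sym (trinom*factorials s+t≤n))) (m*n/n≡m (trinom n s t) _ {{nonZero}})
  where
  nonZero : NonZero ((s ! * t !) * (n ∸ (s + t)) !)
  nonZero = ℕₚ.m*n≢0 (s ! * t !) ((n ∸ (s + t)) !) {{s !* t !≢0}} {{(n ∸ (s + t)) !≢0}}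

s<i⇒inversionCoeff≡0 : ∀ {i s} → s < i → inversionCoeff i s ≡ ℤ.+ 0
s<i⇒inversionCoeff≡0 {i} {s} s<i =
  trans (cong (λ e → sign (i + s) ℤ.* + e) (n<k⇒binom≡0 s<i)) (ℤₚ.*-zeroʳ (sign (i + s)))

2d∸[s+t]<d∸t : ∀ {d s t} → d < s → t ≤ d → s + t ≤ 2 * d → 2 * d ∸ (s + t) < d ∸ t
2d∸[s+t]<d∸t {d} {s} {t} d<s t≤d s+t≤2d = ℕₚ.+-cancelʳ-< (s + t) (2 * d ∸ (s + t)) (d ∸ t) (begin-strict
  2 * d ∸ (s + t) + (s + t)   ≡⟨ ℕₚ.m∸n+n≡m s+t≤2d ⟩
  d + (d + 0)                 ≡⟨ cong (_+_ d) (ℕₚ.+-identityʳ d) ⟩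
  d + d                       <⟨ ℕₚ.+-monoˡ-< d d<s ⟩
  s + d                       ≡⟨ cong (_+_ s) (sym (ℕₚ.m∸n+n≡m t≤d)) ⟩
  s + (d ∸ t + t)             ≡⟨ solve 3 (λ s u t → s :+ (u :+ t) := u :+ (s :+ t)) refl s (d ∸ t) t ⟩
  d ∸ t + (s + t)             ∎)
  where open ℕₚ.≤-Reasoning

closedTerm : (k d i j s t : ℕ) → ℤ
closedTerm k d i j s t = inversionCoeff i s ℤ.* inversionCoeff j t ℤ.* + closedCount k (2 * d) (k * d) s t

rhsTerm : (k d i j s t : ℕ) → ℤ
rhsTerm k d i j s t = sign ((s ∸ i) + (t ∸ j)) ℤ.*
  + (multinom (2 * d) s t * (((2 * d ∸ (s + t)) * k) C ((d ∸ t) * k)) * (s C i) * (t C j))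

module _ {k : ℕ} (k>0 : 0 < k) (d : ℕ) where
  private instance
    k≢0 : NonZero k
    k≢0 = >-nonZero k>0

  closedCount-value : ∀ n s {t} → t ≤ d →
    closedCount k n (k * d) s t ≡ trinom n s t * binom ((n ∸ (s + t)) * k) ((d ∸ t) * k)
  closedCount-value n s {t} t≤d = cong (trinom n s t *_) (trans
    (shift-≤ (binom ((n ∸ (s + t)) * k)) (subst (t * k ≤_) (ℕₚ.*-comm d k) (ℕₚ.*-monoˡ-≤ k t≤d)))
    (cong (binom ((n ∸ (s + t)) * k)) (trans (cong (_∸ t * k) (ℕₚ.*-comm k d)) (sym (ℕₚ.*-distribʳ-∸ k d t)))))

  d<t⇒closedCount≡0 : ∀ n s {t} → d < t → closedCount k n (k * d) s t ≡ 0
  d<t⇒closedCount≡0 n s {t} d<t = trans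
    (cong (trinom n s t *_) (shift-< (binom ((n ∸ (s + t)) * k)) (subst (_< t * k) (ℕₚ.*-comm d k) (ℕₚ.*-monoˡ-< k d<t))))
    (ℕₚ.*-zeroʳ (trinom n s t))

  d<s⇒closedCount≡0 : ∀ {s} t → d < s → closedCount k (2 * d) (k * d) s t ≡ 0
  d<s⇒closedCount≡0 {s} t d<s with s + t ℕₚ.≤? 2 * d | t ℕₚ.≤? d
  ... | no s+t≰2d | _       = cong (_* shift (t * k) (binom ((2 * d ∸ (s + t)) * k)) (k * d)) (n<s+t⇒trinom≡0 (ℕₚ.≰⇒> s+t≰2d))
  ... | yes _     | no t≰d  = d<t⇒closedCount≡0 (2 * d) s (ℕₚ.≰⇒> t≰d)
  ... | yes s+t≤2d | yes t≤d = trans (closedCount-value (2 * d) s t≤d)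
    (trans (cong (trinom (2 * d) s t *_) (n<k⇒binom≡0 (ℕₚ.*-monoˡ-< k (2d∸[s+t]<d∸t d<s t≤d s+t≤2d))))
           (ℕₚ.*-zeroʳ (trinom (2 * d) s t)))

  module _ (i j : ℕ) where

    s<i⇒closedTerm≡0 : ∀ {s} t → s < i → closedTerm k d i j s t ≡ ℤ.+ 0
    s<i⇒closedTerm≡0 {s} t s<i = begin
      inversionCoeff i s ℤ.* inversionCoeff j t ℤ.* + closedCount k (2 * d) (k * d) s t
        ≡⟨ cong (λ e → e ℤ.* inversionCoeff j t ℤ.* + closedCount k (2 * d) (k * d) s t) (s<i⇒inversionCoeff≡0 s<i) ⟩
      ℤ.+ 0 ℤ.* inversionCoeff j t ℤ.* + closedCount k (2 * d) (k * d) s t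
        ≡⟨ trans (cong (ℤ._* + closedCount k (2 * d) (k * d) s t) (ℤₚ.*-zeroˡ (inversionCoeff j t))) (ℤₚ.*-zeroˡ (+ closedCount k (2 * d) (k * d) s t)) ⟩
      ℤ.+ 0 ∎
      where open ≡-Reasoning

    t<j⇒closedTerm≡0 : ∀ s {t} → t < j → closedTerm k d i j s t ≡ ℤ.+ 0
    t<j⇒closedTerm≡0 s {t} t<j = begin
      inversionCoeff i s ℤ.* inversionCoeff j t ℤ.* + closedCount k (2 * d) (k * d) s t
        ≡⟨ cong (λ e → inversionCoeff i s ℤ.* e ℤ.* + closedCount k (2 * d) (k * d) s t) (s<i⇒inversionCoeff≡0 t<j) ⟩
      inversionCoeff i s ℤ.* ℤ.+ 0 ℤ.* + closedCount k (2 * d) (k * d) s t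
        ≡⟨ trans (cong (ℤ._* + closedCount k (2 * d) (k * d) s t) (ℤₚ.*-zeroʳ (inversionCoeff i s))) (ℤₚ.*-zeroˡ (+ closedCount k (2 * d) (k * d) s t)) ⟩
      ℤ.+ 0 ∎
      where open ≡-Reasoning

    d<s⇒closedTerm≡0 : ∀ {s} t → d < s → closedTerm k d i j s t ≡ ℤ.+ 0
    d<s⇒closedTerm≡0 {s} t d<s = trans (cong (λ e → inversionCoeff i s ℤ.* inversionCoeff j t ℤ.* + e) (d<s⇒closedCount≡0 t d<s))
                                       (ℤₚ.*-zeroʳ (inversionCoeff i s ℤ.* inversionCoeff j t))

    d<t⇒closedTerm≡0 : ∀ s {t} → d < t → closedTerm k d i j s t ≡ ℤ.+ 0
    d<t⇒closedTerm≡0 s {t} d<t = trans (cong (λ e → inversionCoeff i s ℤ.* inversionCoeff j t ℤ.* + e) (d<t⇒closedCount≡0 (2 * d) s d<t))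
                                       (ℤₚ.*-zeroʳ (inversionCoeff i s ℤ.* inversionCoeff j t))

  closedTerm≡rhsTerm : ∀ {i j s t} → i ≤ s → s ≤ d → j ≤ t → t ≤ d → closedTerm k d i j s t ≡ rhsTerm k d i j s t
  closedTerm≡rhsTerm {i} {j} {s} {t} i≤s s≤d j≤t t≤d = begin
    sign (i + s) ℤ.* + binom s i ℤ.* (sign (j + t) ℤ.* + binom t j) ℤ.* + closedCount k (2 * d) (k * d) s t
      ≡⟨ cong (λ e → sign (i + s) ℤ.* + binom s i ℤ.* (sign (j + t) ℤ.* + binom t j) ℤ.* + e)
           (closedCount-value (2 * d) s t≤d) ⟩
    sign (i + s) ℤ.* + binom s i ℤ.* (sign (j + t) ℤ.* + binom t j) ℤ.* + X
      ≡⟨ regroup (sign (i + s)) (+ binom s i) (sign (j + t)) (+ binom t j) (+ X) ⟩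
    sign (i + s) ℤ.* sign (j + t) ℤ.* (+ X ℤ.* + binom s i ℤ.* + binom t j)
      ≡⟨ cong₂ ℤ._*_ signs (sym (trans (ℤₚ.pos-* (X * binom s i) (binom t j)) (cong (ℤ._* + binom t j) (ℤₚ.pos-* X (binom s i))))) ⟩
    sign ((s ∸ i) + (t ∸ j)) ℤ.* + (X * binom s i * binom t j)
      ≡⟨ cong (λ e → sign ((s ∸ i) + (t ∸ j)) ℤ.* + e) naturals ⟩
    sign ((s ∸ i) + (t ∸ j)) ℤ.* + (multinom (2 * d) s t * (((2 * d ∸ (s + t)) * k) C ((d ∸ t) * k)) * (s C i) * (t C j)) ∎
    where
    open ≡-Reasoning
    X = trinom (2 * d) s t * binom ((2 * d ∸ (s + t)) * k) ((d ∸ t) * k)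
    regroup : ∀ σ b τ c x → σ ℤ.* b ℤ.* (τ ℤ.* c) ℤ.* x ≡ σ ℤ.* τ ℤ.* (x ℤ.* b ℤ.* c)
    regroup = ℤ-Solver.solve-∀
    signs : sign (i + s) ℤ.* sign (j + t) ≡ sign ((s ∸ i) + (t ∸ j))
    signs = trans (cong₂ ℤ._*_ (sign-∸ i≤s) (sign-∸ j≤t)) (sym (sign-+ (s ∸ i) (t ∸ j)))
    s+t≤2d : s + t ≤ 2 * d
    s+t≤2d = subst (s + t ≤_) (cong (_+_ d) (sym (ℕₚ.+-identityʳ d))) (ℕₚ.+-mono-≤ s≤d t≤d)
    naturals : X * binom s i * binom t j
             ≡ multinom (2 * d) s t * (((2 * d ∸ (s + t)) * k) C ((d ∸ t) * k)) * (s C i) * (t C j)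
    naturals = cong₂ _*_ (cong₂ _*_ (cong₂ _*_ (sym (multinom≡trinom s+t≤2d)) (binom≡C ((2 * d ∸ (s + t)) * k) ((d ∸ t) * k))) (binom≡C s i)) (binom≡C t j)

Σ[⋯]≡∑< : ∀ a b (f : ℕ → ℤ) → Σ[ a ⋯ b ] f ≡ ℤΣ.∑< (suc b ∸ a) (λ r → f (a + r))
Σ[⋯]≡∑< a b f = ℤΣ.foldr-applyUpTo (suc b ∸ a) (λ r → f (a + r))

i+r≤d : ∀ {i d r} → i ≤ d → r < suc d ∸ i → i + r ≤ d
i+r≤d {i} {d} {r} i≤d r<L =
  ℕₚ.≤-pred (subst (i + r <_) (ℕₚ.m+[n∸m]≡n (ℕₚ.m≤n⇒m≤1+n i≤d)) (ℕₚ.+-monoʳ-< i r<L))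

Φ-formula : ∀ {k} → 0 < k → ∀ d {i j} → i ≤ d → j ≤ d → + Φ (k * d) d k i j ≡ RHS d k i j
Φ-formula {k} k>0 d {i} {j} i≤d j≤d = begin
  + Φ (k * d) d k i j
    ≡⟨ Φ-inverted k d i j (k * d) ⟩
  ℤΣ.∑< (suc N) (λ s → ℤΣ.∑< (suc N) (λ t → inversionCoeff i s ℤ.* inversionCoeff j t ℤ.* + markedCount N (k * d) s t))
    ≡⟨ ℤΣ.∑<-cong (suc N) (λ s _ → ℤΣ.∑<-cong (suc N) (λ t _ →
         cong (λ e → inversionCoeff i s ℤ.* inversionCoeff j t ℤ.* + e) (markedCount≡closedCount k>0 N (k * d) s t))) ⟩
  ℤΣ.∑< (suc N) (λ s → ℤΣ.∑< (suc N) (closedTerm k d i j s))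
    ≡⟨ ℤΣ.∑<-restrict (λ s → ℤΣ.∑< (suc N) (closedTerm k d i j s)) i≤d d≤N
         (λ s s<i → ℤΣ.∑<-zero (suc N) (λ t _ → s<i⇒closedTerm≡0 k>0 d i j t s<i))
         (λ s d<s → ℤΣ.∑<-zero (suc N) (λ t _ → d<s⇒closedTerm≡0 k>0 d i j t d<s)) ⟩
  ℤΣ.∑< (suc d ∸ i) (λ r → ℤΣ.∑< (suc N) (closedTerm k d i j (i + r)))
    ≡⟨ ℤΣ.∑<-cong (suc d ∸ i) (λ r _ → ℤΣ.∑<-restrict (closedTerm k d i j (i + r)) j≤d d≤N
         (λ t t<j → t<j⇒closedTerm≡0 k>0 d i j (i + r) t<j)
         (λ t d<t → d<t⇒closedTerm≡0 k>0 d i j (i + r) d<t)) ⟩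
  ℤΣ.∑< (suc d ∸ i) (λ r → ℤΣ.∑< (suc d ∸ j) (λ r′ → closedTerm k d i j (i + r) (j + r′)))
    ≡⟨ ℤΣ.∑<-cong (suc d ∸ i) (λ r r<L → ℤΣ.∑<-cong (suc d ∸ j) (λ r′ r′<L →
         closedTerm≡rhsTerm k>0 d (ℕₚ.m≤m+n i r) (i+r≤d i≤d r<L) (ℕₚ.m≤m+n j r′) (i+r≤d j≤d r′<L))) ⟩
  ℤΣ.∑< (suc d ∸ i) (λ r → ℤΣ.∑< (suc d ∸ j) (λ r′ → rhsTerm k d i j (i + r) (j + r′)))
    ≡⟨ sym (trans (Σ[⋯]≡∑< i d (λ s → Σ[ j ⋯ d ] (rhsTerm k d i j s)))
                  (ℤΣ.∑<-cong (suc d ∸ i) (λ r _ → Σ[⋯]≡∑< j d (rhsTerm k d i j (i + r))))) ⟩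
  RHS d k i j ∎
  where
  open ≡-Reasoning
  open MarkedCount k using (markedCount; markedCount≡closedCount)
  N = 2 * d
  d≤N : d ≤ N
  d≤N = ℕₚ.m≤m+n d (1 * d)

lemma3p5 : (p k d : ℕ) → 4 ≤ p → p ≡ k * d → 1 < k → k < p → 1 < d → d < p →
    (i j : ℕ) → i ≤ d → j ≤ d →
    + (Φ p d k i j) ≡ RHS d k i j
lemma3p5 .(k * d) k d _ refl 1<k _ _ _ i j i≤d j≤d = Φ-formula (ℕₚ.<-trans (s≤s z≤n) 1<k) d i≤d j≤d
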